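{- Let $\lambda,\mu$ be partitions with at most $n$ parts, $\mu\subseteq\lambda$, and let $r,s$ be weakly increasing sequences of $n$ positive integers. If $s_k<r_k$ and $\mu_k<\lambda_k$ for some $1\le k\le n$, then \[ G^{\mathrm{row}(r,s)}_{\lambda/\mu}(x;\alpha,\beta)=\widetilde G^{\mathrm{row}(r,s)}_{\lambda/\mu}(x;\alpha,\beta)=0. \]
   Context: Indeterminates $x=(x_1,x_2,\dots)$, $\alpha=(\alpha_i)$, $\beta=(\beta_i)$. $A_m=\alpha_1+\dots+\alpha_m$, $B_m=\beta_1+\dots+\beta_m$ ($=0$ for $m\le0$); $X_{[r,s]}=x_r+\dots+x_s$ ($=0$ if $r>s$). For a formal $\mathbb Z$-linear combination $Z=\sum_vc_vv$ of finitely many indeterminates, $h_m[Z]$ is the coefficient of $t^m$ in $\prod_v(1-vt)^{ -c_v}$; $h_m[Y\ominus Z]=\sum_{b\ge0}h_{m+b}[Y]h_b[Z]$. For partitions $\lambda,\mu$ with at most $n$ parts (padded with zeros) and $r,s\in\mathbb Z_{\ge0}^n$, \[ \widetilde G^{\mathrm{row}(r,s)}_{\lambda/\mu}(x;\alpha,\beta)=\prod_{i=1}^n\prod_{l=r_i}^{s_i}(1-\beta_ix_l)\cdot\det\Big(h_{\lambda_i-\mu_j-i+j}\big[X_{[r_j,s_i]}\ominus(A_{\lambda_i}-A_{\mu_j}-B_{i-1}+B_j)\big]\Big)_{i,j=1}^n. \] A marked multiset-valued tableau of skew shape $\lambda/\mu$ (cells $(i,j)$ with $\mu_i<j\le\lambda_i$)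 is a filling $T$ with nonempty finite multisets $\{a_1\le\dots\le a_k\}$ of positive integers, where each $a_t$ with $t\ge2$, $a_{t-1}<a_t$ may be marked, such that $\max T(i,j)\le\min T(i,j+1)$ and $\max T(i,j)<\min T(i+1,j)$ whenever both cells are in the shape; $\mathrm{wt}(T)=\prod x^{T(i,j)}\alpha_j^{u(i,j)-1}(-\beta_i)^{m(i,j)}$ with $x^{T(i,j)}=\prod_kx_k^{(\#k\text{ in }T(i,j))}$, $u,m$ the numbers of unmarked/marked elements. $G^{\mathrm{row}(r,s)}_{\lambda/\mu}(x;\alpha,\beta)$ is the sum of $\mathrm{wt}(T)$ over such $T$ with $r_i\le\min T(i,j)$, $\max T(i,j)\le s_i$ for all cells. -}

module Defs where

open import Data.Nat as ℕ using (ℕ; zero; suc; _∸_; _≤ᵇ_; _<ᵇ_; _⊔_)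
open import Data.Nat.Combinatorics using (_C_)
open import Data.Integer as ℤ using (ℤ; +_; -[1+_]; 0ℤ; 1ℤ)
open import Data.Bool using (Bool; true; false; if_then_else_; _∧_; not)
open import Data.Fin as Fin using (Fin; toℕ; _↑ˡ_; _↑ʳ_; punchIn)
open import Data.List as List using (List; []; _∷_; _++_; map; concatMap; upTo; allFin; foldr)
open import Data.Maybe as Maybe using (Maybe; just; nothing)
open import Data.Vec as Vec using (Vec; []; _∷_; zipWith; replicate; _[_]≔_)
import Data.Vec.Properties as VecP
open import Data.Product using (_×_; _,_; proj₁; proj₂)
open import Relation.Nullary using (does)
open import Relation.Binary.PropositionalEquality using (_≡_)

-- Formal power series with integer coefficients in N commuting
-- variables (indexed by Fin N): a series is its coefficient function
-- on exponent vectors.  Equality is coefficientwise.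

Mono : ℕ → Set
Mono N = Vec ℕ N

Ser : ℕ → Set
Ser N = Mono N → ℤ

_≈_ : ∀ {N} → Ser N → Ser N → Set
f ≈ g = ∀ e → f e ≡ g e

sumℤ : List ℤ → ℤ
sumℤ = foldr ℤ._+_ 0ℤ

zeroM : ∀ {N} → Mono N
zeroM = replicate _ 0

_+m_ : ∀ {N} → Mono N → Mono N → Mono N
_+m_ = zipWith ℕ._+_

deg : ∀ {N} → Mono N → ℕ
deg = Vec.sum

_==m_ : ∀ {N} → Mono N → Mono N → Bool
a ==m b = does (VecP.≡-dec ℕ._≟_ a b)

below : ∀ {N} → Mono N → List (Mono N)
below []      = [] ∷ []
below (k ∷ e) = concatMap (λ d → map (d ∷_) (below e)) (upTo (suc k))

monoS : ∀ {N} → Mono N → Ser N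
monoS m e = if m ==m e then 1ℤ else 0ℤ

0s 1s : ∀ {N} → Ser N
0s _ = 0ℤ
1s = monoS zeroM

constS : ∀ {N} → ℤ → Ser N
constS c e = c ℤ.* 1s e

_+s_ : ∀ {N} → Ser N → Ser N → Ser N
(f +s g) e = f e ℤ.+ g e

-s_ : ∀ {N} → Ser N → Ser N
(-s f) e = ℤ.- f e

_-s_ : ∀ {N} → Ser N → Ser N → Ser N
f -s g = f +s (-s g)

_*s_ : ∀ {N} → Ser N → Ser N → Ser N
(f *s g) e = sumℤ (map (λ d → f d ℤ.* g (zipWith _∸_ e d)) (below e))

_^s_ : ∀ {N} → Ser N → ℕ → Ser N
f ^s zero  = 1s
f ^s suc k = f *s (f ^s k)

sumS : ∀ {N} → List (Ser N) → Ser N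
sumS = foldr _+s_ 0s

prodS : ∀ {N} → List (Ser N) → Ser N
prodS = foldr _*s_ 1s

-- Infinite sum Σ_{b ≥ 0} f b of a family in which f b only has
-- monomials of total degree ≥ b (locally finite family): the
-- coefficient at e only receives contributions from b ≤ deg e.
Σ∞ : ∀ {N} → (ℕ → Ser N) → Ser N
Σ∞ f e = sumℤ (map (λ b → f b e) (upTo (suc (deg e))))

signℤ : ℕ → ℤ
signℤ zero    = 1ℤ
signℤ (suc k) = ℤ.- signℤ k

det : ∀ {N} n → (Fin n → Fin n → Ser N) → Ser N
det zero    M = 1s
det (suc n) M = sumS (map (λ j → constS (signℤ (toℕ j)) *s
                   (M Fin.zero j *s det n (λ a b → M (Fin.suc a) (punchIn j b))))
                   (allFin (suc n)))

-- a formal ℤ-linear combination Σ c_v v, as a list of (c_v , v)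
Comb : ℕ → Set
Comb N = List (ℤ × Ser N)

-- coefficient of t^k in (1 - v t)^(-c)
ecoef : ∀ {N} → ℤ → Ser N → ℕ → Ser N
ecoef (+ d)      v k = constS (+ ((d ℕ.+ k ∸ 1) C k)) *s (v ^s k)
ecoef -[1+ d ]   v k = constS (signℤ k ℤ.* + (suc d C k)) *s (v ^s k)

-- h_m[Z] = coefficient of t^m in Π_v (1 - v t)^(-c_v)
hN : ∀ {N} → Comb N → ℕ → Ser N
hN []            m = if m ℕ.≡ᵇ 0 then 1s else 0s
hN ((c , v) ∷ Z) m = sumS (map (λ k → ecoef c v k *s hN Z (m ∸ k)) (upTo (suc m)))

hZ : ∀ {N} → Comb N → ℤ → Ser N
hZ Z (+ m)    = hN Z m
hZ Z -[1+ _ ] = 0s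

hDiff : ∀ {N} → Comb N → Comb N → ℤ → Ser N
hDiff Y Z m = Σ∞ (λ b → hZ Y (m ℤ.+ + b) *s hN Z b)

-- [a, a+1, ..., b] (empty if a > b)
range : ℕ → ℕ → List ℕ
range a b = map (a ℕ.+_) (upTo (suc b ∸ a))

toFin? : (K l : ℕ) → Maybe (Fin K)
toFin? zero    _       = nothing
toFin? (suc K) zero    = just Fin.zero
toFin? (suc K) (suc l) = Maybe.map Fin.suc (toFin? K l)

-- 1-based index l ∈ {1..K}
idx1 : (K l : ℕ) → Maybe (Fin K)
idx1 K zero    = nothing
idx1 K (suc l) = toFin? K l

maxF : ∀ {n} → (Fin n → ℕ) → ℕ
maxF {n} f = foldr _⊔_ 0 (map f (allFin n))

-- variables x_1..x_S, α_1..α_L, β_1..β_n laid out in Fin (S + (L + n))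
module Vars (S L n : ℕ) where
  N : ℕ
  N = S ℕ.+ (L ℕ.+ n)

  xI αI βI : ℕ → Maybe (Fin N)
  xI l = Maybe.map (_↑ˡ (L ℕ.+ n)) (idx1 S l)
  αI j = Maybe.map (λ f → S ↑ʳ (f ↑ˡ n)) (idx1 L j)
  βI i = Maybe.map (λ f → S ↑ʳ (L ↑ʳ f)) (idx1 n i)

  powM : Maybe (Fin N) → ℕ → Mono N
  powM nothing  k = zeroM
  powM (just f) k = zeroM [ f ]≔ k

  varS : Maybe (Fin N) → Ser N
  varS i = monoS (powM i 1)

  x α β : ℕ → Ser N
  x l = varS (xI l)
  α j = varS (αI j)
  β i = varS (βI i)

Nv : (n : ℕ) → (Fin n → ℕ) → (Fin n → ℕ) → ℕ
Nv n la s = Vars.N (maxF s) (maxF la) n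

-- The determinantal expression  G̃^{row(r,s)}_{λ/μ}(x;α,β).
-- Rows/columns i , j : Fin n stand for the 1-based indices toℕ i + 1.

Gtilde : (n : ℕ) (la mu r s : Fin n → ℕ) → Ser (Nv n la s)
Gtilde n la mu r s = prefactor *s det n entry
  where
  open Vars (maxF s) (maxF la) n
  I : Fin n → ℕ
  I i = suc (toℕ i)
  pos neg : (ℕ → Ser N) → List ℕ → Comb N
  pos v ts = map (λ t → (ℤ.+ 1 , v t)) ts
  neg v ts = map (λ t → (ℤ.- (ℤ.+ 1) , v t)) ts
  Y : Fin n → Fin n → Comb N
  Y i j = pos x (range (r j) (s i))
  Z : Fin n → Fin n → Comb N
  Z i j = pos α (range 1 (la i)) ++ neg α (range 1 (mu j))
       ++ neg β (range 1 (I i ∸ 1)) ++ pos β (range 1 (I j))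
  idx : Fin n → Fin n → ℤ
  idx i j = ((+ la i ℤ.- + mu j) ℤ.- + I i) ℤ.+ + I j
  entry : Fin n → Fin n → Ser N
  entry i j = hDiff (Y i j) (Z i j) (idx i j)
  prefactor : Ser N
  prefactor = prodS (map (λ i → prodS (map (λ l → 1s -s (β (I i) *s x l))
                (range (r i) (s i)))) (allFin n))

-- The tableau sum  G^{row(r,s)}_{λ/μ}(x;α,β).
-- A cell entry is a marked multiset, represented canonically as the
-- weakly increasing list a_1 ≤ … ≤ a_k with a mark flag on each element.

Entry : Set
Entry = ℕ × Bool

Content : Set
Content = List Entry

okTail : ℕ → Content → Bool
okTail p []             = true
okTail p ((b , mb) ∷ c) = (p ≤ᵇ b) ∧ (if mb then p <ᵇ b else true) ∧ okTail b c

inRange : ℕ → ℕ → Content → Bool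
inRange lo hi c = foldr (λ en acc → (1 ≤ᵇ proj₁ en) ∧ (lo ≤ᵇ proj₁ en) ∧ (proj₁ en ≤ᵇ hi) ∧ acc) true c

validCell : ℕ → ℕ → Content → Bool
validCell lo hi []             = false
validCell lo hi ((a , ma) ∷ c) = not ma ∧ okTail a c ∧ inRange lo hi ((a , ma) ∷ c)

minC maxC : Content → ℕ
minC []      = 0
minC (en ∷ _) = proj₁ en
maxC []       = 0
maxC (en ∷ []) = proj₁ en
maxC (_ ∷ en ∷ c) = maxC (en ∷ c)

nUnmarked nMarked : Content → ℕ
nUnmarked = foldr (λ en k → if proj₂ en then k else suc k) 0
nMarked   = foldr (λ en k → if proj₂ en then suc k else k) 0

listsOf : ∀ {A : Set} → ℕ → List A → List (List A)
listsOf zero    as = [] ∷ []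
listsOf (suc k) as = concatMap (λ a → map (a ∷_) (listsOf k as)) as

allVecs : ∀ {A : Set} n → (Fin n → List A) → List (Vec A n)
allVecs zero    f = [] ∷ []
allVecs (suc n) f = concatMap (λ a → map (a ∷_) (allVecs n (λ i → f (Fin.suc i)))) (f Fin.zero)

at : ∀ {A : Set} → ℕ → List A → Maybe A
at _       []      = nothing
at zero    (a ∷ _) = just a
at (suc k) (_ ∷ as) = at k as

rowOK : List Content → Bool
rowOK []           = true
rowOK (c ∷ [])     = true
rowOK (c ∷ d ∷ cs) = (maxC c ≤ᵇ minC d) ∧ rowOK (d ∷ cs)

allB : ∀ {A : Set} → (A → Bool) → List A → Bool
allB p = foldr (λ a acc → p a ∧ acc) true

Grow : (n : ℕ) (la mu r s : Fin n → ℕ) → Ser (Nv n la s)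
Grow n la mu r s e = sumℤ (map term (allVecs n (λ i → listsOf (la i ∸ mu i) (cands i))))
  where
  open Vars (maxF s) (maxF la) n
  I : Fin n → ℕ
  I i = suc (toℕ i)
  D : ℕ
  D = deg e
  -- candidate cell contents for row i: entries in [r_i, s_i], size 1..D
  -- (a tableau of weight x^e has at most deg e elements in each cell)
  cands : Fin n → List Content
  cands i = concatMap (λ k → listsOf k (concatMap (λ a → (a , false) ∷ (a , true) ∷ [])
              (range (r i) (s i)))) (range 1 D)
  Tab : Set
  Tab = Vec (List Content) n
  -- T(i , j), j the 1-based column
  cell : Tab → Fin n → ℕ → Maybe Content
  cell T i j = at (j ∸ suc (mu i)) (Vec.lookup T i)
  colPair : Tab → Fin n → Fin n → Bool
  colPair T i i' = allB (λ j → if (mu i <ᵇ j) ∧ (j ≤ᵇ la i) then chk (cell T i j) (cell T i' j) else true)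
                        (range (suc (mu i')) (la i'))
    where
    chk : Maybe Content → Maybe Content → Bool
    chk (just c) (just d) = maxC c <ᵇ minC d
    chk _ _ = true
  colOK : Tab → Fin n → Bool
  colOK T i with toFin? n (suc (toℕ i))
  ... | just i' = colPair T i i'
  ... | nothing = true
  valid : Tab → Bool
  valid T = allB (λ i → allB (validCell (r i) (s i)) (Vec.lookup T i)
                       ∧ rowOK (Vec.lookup T i) ∧ colOK T i) (allFin n)
  cellMono : Fin n → ℕ → Content → Mono N
  cellMono i j c = foldr (λ en m → powM (xI (proj₁ en)) 1 +m m) zeroM c
                   +m (powM (αI j) (nUnmarked c ∸ 1) +m powM (βI (I i)) (nMarked c))
  rowMono : Fin n → ℕ → List Content → Mono N
  rowMono i j []       = zeroM
  rowMono i j (c ∷ cs) = cellMono i j c +m rowMono i (suc j) cs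
  mono : Tab → Mono N
  mono T = foldr (λ i m → rowMono i (suc (mu i)) (Vec.lookup T i) +m m) zeroM (allFin n)
  marks : Tab → ℕ
  marks T = foldr (λ i k → foldr (λ c k' → nMarked c ℕ.+ k') 0 (Vec.lookup T i) ℕ.+ k) 0 (allFin n)
  term : Tab → ℤ
  term T = if valid T ∧ (mono T ==m e) then signℤ (marks T) else 0ℤ

{-# OPTIONS --safe #-}
-- Row k of λ/μ has a cell whose entries would have to lie in the empty interval [r_k, s_k],
-- so there are no tableaux and G = 0. In the determinant, for i ≤ k ≤ j monotonicity gives
-- s_i ≤ s_k < r_k ≤ r_j and λ_i - μ_j - i + j ≥ λ_k - μ_k > 0, so the (i, j) entry is
-- h_m[∅ ⊖ Z] with m > 0, which is 0; a (k + 1) × (n - k) zero block forces det = 0.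
module Submission where

open import Defs
open import Data.Nat using (ℕ; _≤_; _<_)
open import Data.Fin using (Fin)
import Data.Fin as Fin
open import Data.Product using (_×_; ∃)

open import Data.Nat using (zero; suc; z≤n; s≤s; _∸_)
import Data.Nat.Properties as ℕP
open import Data.Fin using (toℕ; punchIn)
open import Data.Integer as ℤ using (ℤ; +_; 0ℤ; 1ℤ; +<+)
import Data.Integer.Properties as ℤP
open import Data.Integer.Solver using (module +-*-Solver)
open import Data.List using (List; []; _∷_; _++_; map; concatMap; upTo; allFin)
open import Data.List.Properties using (concatMap-map)
open import Data.Vec as Vec using (zipWith)
open import Data.Product using (_,_)
open import Relation.Binary.PropositionalEquality
open import Relation.Nullary using (Dec; yes; no)

sumℤ-map-zero : ∀ {A : Set} (f : A → ℤ) (xs : List A) → (∀ a → f a ≡ 0ℤ) → sumℤ (map f xs) ≡ 0ℤ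
sumℤ-map-zero f []       f≡0 = refl
sumℤ-map-zero f (a ∷ xs) f≡0 rewrite f≡0 a | sumℤ-map-zero f xs f≡0 = refl

sumℤ-map-[] : ∀ {A : Set} {f : A → ℤ} {xs : List A} → xs ≡ [] → sumℤ (map f xs) ≡ 0ℤ
sumℤ-map-[] refl = refl

sumS-map-zero : ∀ {N} {A : Set} (F : A → Ser N) (xs : List A) → (∀ a → F a ≈ 0s) → sumS (map F xs) ≈ 0s
sumS-map-zero F []       F≈0 e = refl
sumS-map-zero F (a ∷ xs) F≈0 e rewrite F≈0 a e | sumS-map-zero F xs F≈0 e = refl

*s-zeroˡ : ∀ {N} {f : Ser N} (g : Ser N) → f ≈ 0s → (f *s g) ≈ 0s
*s-zeroˡ g f≈0 e = sumℤ-map-zero _ (below e) λ d →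
  trans (cong (ℤ._* g (zipWith _∸_ e d)) (f≈0 d)) (ℤP.*-zeroˡ (g (zipWith _∸_ e d)))

*s-zeroʳ : ∀ {N} (f : Ser N) {g : Ser N} → g ≈ 0s → (f *s g) ≈ 0s
*s-zeroʳ f g≈0 e = sumℤ-map-zero _ (below e) λ d →
  trans (cong (f d ℤ.*_) (g≈0 (zipWith _∸_ e d))) (ℤP.*-zeroʳ (f d))

minor : ∀ {A : Set} {n} → (Fin (suc n) → Fin (suc n) → A) → Fin (suc n) → Fin n → Fin n → A
minor M j a b = M (Fin.suc a) (punchIn j b)

ZeroCorner : ∀ {N n} → (Fin n → Fin n → Ser N) → Fin n → Set
ZeroCorner M k = ∀ i j → i Fin.≤ k → k Fin.≤ j → M i j ≈ 0s

toℕ-punchIn-≥ : ∀ {n} (j : Fin (suc n)) (b : Fin n) → toℕ j ≤ toℕ b → toℕ (punchIn j b) ≡ suc (toℕ b)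
toℕ-punchIn-≥ Fin.zero    b           _         = refl
toℕ-punchIn-≥ (Fin.suc j) (Fin.suc b) (s≤s j≤b) = cong suc (toℕ-punchIn-≥ j b j≤b)

ZeroCorner-minor : ∀ {N n} (M : Fin (suc n) → Fin (suc n) → Ser N) {j : Fin (suc n)} {k : Fin n}
  → toℕ j ≤ toℕ k → ZeroCorner M (Fin.suc k) → ZeroCorner (minor M j) k
ZeroCorner-minor M {j} {k} j≤k M≈0 a b a≤k k≤b = M≈0 (Fin.suc a) (punchIn j b) (s≤s a≤k) (begin
  suc (toℕ k)        ≤⟨ s≤s k≤b ⟩
  suc (toℕ b)        ≡⟨ toℕ-punchIn-≥ j b (ℕP.≤-trans j≤k k≤b) ⟨
  toℕ (punchIn j b)  ∎)
  where open ℕP.≤-Reasoning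

det-by-first-row≈0s : ∀ {N} n (M : Fin (suc n) → Fin (suc n) → Ser N)
  → (∀ j → (M Fin.zero j *s det n (minor M j)) ≈ 0s) → det (suc n) M ≈ 0s
det-by-first-row≈0s n M terms≈0 =
  sumS-map-zero _ (allFin (suc n)) λ j → *s-zeroʳ (constS (signℤ (toℕ j))) (terms≈0 j)

det-zero-corner : ∀ {N} n (M : Fin n → Fin n → Ser N) (k : Fin n) → ZeroCorner M k → det n M ≈ 0s
det-zero-corner (suc n) M Fin.zero M≈0 =
  det-by-first-row≈0s n M λ j → *s-zeroˡ (det n (minor M j)) (M≈0 Fin.zero j z≤n z≤n)
det-zero-corner (suc n) M (Fin.suc k) M≈0 =
  det-by-first-row≈0s n M λ j → term≈0 j (Fin.suc k Fin.≤? j)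
  where
  term≈0 : ∀ j → Dec (Fin.suc k Fin.≤ j) → (M Fin.zero j *s det n (minor M j)) ≈ 0s
  term≈0 j (yes k<j) = *s-zeroˡ (det n (minor M j)) (M≈0 Fin.zero j z≤n k<j)
  term≈0 j (no  k≮j) = *s-zeroʳ (M Fin.zero j)
    (det-zero-corner n (minor M j) k (ZeroCorner-minor M (ℕP.≤-pred (ℕP.≰⇒> k≮j)) M≈0))

hZ-[]-pos : ∀ {N} {m} → 0ℤ ℤ.< m → hZ {N} [] m ≈ 0s
hZ-[]-pos {m = + suc _} _ _ = refl
hZ-[]-pos {m = + zero}  (+<+ ())

hDiff-[]-pos : ∀ {N} (Z : Comb N) {m} → 0ℤ ℤ.< m → hDiff [] Z m ≈ 0s
hDiff-[]-pos Z 0<m e = sumℤ-map-zero _ (upTo (suc (deg e))) λ b →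
  *s-zeroˡ (hN Z b) (hZ-[]-pos (ℤP.<-≤-trans 0<m (ℤP.i≤i+j _ (+ b)))) e

range-empty : ∀ {a b} → b < a → range a b ≡ []
range-empty b<a rewrite ℕP.m≤n⇒m∸n≡0 b<a = refl

0<a-b-c+d : ∀ {a b c d} → b < a → c ≤ d → 0ℤ ℤ.< ((+ a ℤ.- + b) ℤ.- + c) ℤ.+ + d
0<a-b-c+d {b = b} {c} b<a c≤d with ℕP.m≤n⇒∃[o]m+o≡n b<a | ℕP.m≤n⇒∃[o]m+o≡n c≤d
... | p , refl | q , refl = subst (0ℤ ℤ.<_) (sym (telescope (+ b) (+ p) (+ c) (+ q))) (+<+ (s≤s z≤n))
  where
  open +-*-Solver
  telescope : ∀ b p c q → ((1ℤ ℤ.+ b ℤ.+ p) ℤ.- b ℤ.- c) ℤ.+ (c ℤ.+ q) ≡ 1ℤ ℤ.+ p ℤ.+ q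
  telescope = solve 4 (λ b p c q → ((con 1ℤ :+ b :+ p) :- b :- c) :+ (c :+ q) := con 1ℤ :+ p :+ q) refl

-- Gtilde's where-bound definitions cannot be named, and unification cannot recover them through
-- _*s_ (which unfolds to sign/magnitude arithmetic on ℤ), so they are restated; they agree with
-- those of Defs definitionally.
module GtildeExpansion (n : ℕ) (la mu r s : Fin n → ℕ) where
  open Vars (maxF s) (maxF la) n

  I : Fin n → ℕ
  I i = suc (toℕ i)

  pos neg : (ℕ → Ser N) → List ℕ → Comb N
  pos v ts = map (λ t → (+ 1 , v t)) ts
  neg v ts = map (λ t → (ℤ.- + 1 , v t)) ts

  Y Z : Fin n → Fin n → Comb N
  Y i j = pos x (range (r j) (s i))
  Z i j = pos α (range 1 (la i)) ++ neg α (range 1 (mu j))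
       ++ neg β (range 1 (I i ∸ 1)) ++ pos β (range 1 (I j))

  idx : Fin n → Fin n → ℤ
  idx i j = ((+ la i ℤ.- + mu j) ℤ.- + I i) ℤ.+ + I j

  entry : Fin n → Fin n → Ser N
  entry i j = hDiff (Y i j) (Z i j) (idx i j)

  prefactor : Ser N
  prefactor = prodS (map (λ i → prodS (map (λ l → 1s -s (β (I i) *s x l)) (range (r i) (s i)))) (allFin n))

  entry≈0s : ∀ i j → s i < r j → mu j < la i → i Fin.≤ j → entry i j ≈ 0s
  entry≈0s i j si<rj muj<lai i≤j =
    subst (λ X → hDiff X (Z i j) (idx i j) ≈ 0s) (sym (cong (pos x) (range-empty si<rj)))
      (hDiff-[]-pos (Z i j) (0<a-b-c+d muj<lai (s≤s i≤j)))

Gtilde≈0s : ∀ n (la mu r s : Fin n → ℕ)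
  → (∀ i j → i Fin.≤ j → la j ≤ la i)
  → (∀ i j → i Fin.≤ j → mu j ≤ mu i)
  → (∀ i j → i Fin.≤ j → r i ≤ r j)
  → (∀ i j → i Fin.≤ j → s i ≤ s j)
  → ∀ k → s k < r k → mu k < la k → Gtilde n la mu r s ≈ 0s
Gtilde≈0s n la mu r s la↓ mu↓ r↑ s↑ k sk<rk muk<lak =
  *s-zeroʳ prefactor (det-zero-corner n entry k entries≈0s)
  where
  open GtildeExpansion n la mu r s
  open ℕP.≤-Reasoning
  entries≈0s : ZeroCorner entry k
  entries≈0s i j i≤k k≤j = entry≈0s i j
    (begin-strict s i ≤⟨ s↑ i k i≤k ⟩ s k <⟨ sk<rk ⟩ r k ≤⟨ r↑ k j k≤j ⟩ r j ∎)
    (begin-strict mu j ≤⟨ mu↓ k j k≤j ⟩ mu k <⟨ muk<lak ⟩ la k ≤⟨ la↓ i k i≤k ⟩ la i ∎)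
    (ℕP.≤-trans i≤k k≤j)

concatMap-≡[] : ∀ {A B : Set} (f : A → List B) (xs : List A) → (∀ a → f a ≡ []) → concatMap f xs ≡ []
concatMap-≡[] f []       f≡[] = refl
concatMap-≡[] f (a ∷ xs) f≡[] rewrite f≡[] a = concatMap-≡[] f xs f≡[]

allVecs-≡[] : ∀ {A : Set} n {F : Fin n → List A} (k : Fin n) → F k ≡ [] → allVecs n F ≡ []
allVecs-≡[] (suc n) {F} Fin.zero    Fk≡[] rewrite Fk≡[] = refl
allVecs-≡[] (suc n) {F} (Fin.suc k) Fk≡[] =
  concatMap-≡[] _ (F Fin.zero) λ a → cong (map (a Vec.∷_)) (allVecs-≡[] n k Fk≡[])

listsOf-[] : ∀ {A : Set} d {xs : List A} → 0 < d → xs ≡ [] → listsOf d xs ≡ []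
listsOf-[] (suc d) _ refl = refl

concatMap-listsOf-[] : ∀ {A : Set} D {xs : List A} → xs ≡ [] → concatMap (λ m → listsOf m xs) (range 1 D) ≡ []
concatMap-listsOf-[] D refl =
  trans (concatMap-map (λ m → listsOf m []) suc (upTo D)) (concatMap-≡[] _ (upTo D) λ _ → refl)

Grow≈0s : ∀ n (la mu r s : Fin n → ℕ) k → s k < r k → mu k < la k → Grow n la mu r s ≈ 0s
Grow≈0s n la mu r s k sk<rk muk<lak e =
  sumℤ-map-[] (allVecs-≡[] n k
    (listsOf-[] (la k ∸ mu k) (ℕP.m<n⇒0<n∸m muk<lak)
      (concatMap-listsOf-[] (deg e) (cong (concatMap _) (range-empty sk<rk)))))

lemma3p14 : (n : ℕ) (la mu r s : Fin n → ℕ)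
    → (∀ (i j : Fin n) → i Fin.≤ j → la j ≤ la i)
    → (∀ (i j : Fin n) → i Fin.≤ j → mu j ≤ mu i)
    → (∀ (i : Fin n) → mu i ≤ la i)
    → (∀ (i j : Fin n) → i Fin.≤ j → r i ≤ r j)
    → (∀ (i j : Fin n) → i Fin.≤ j → s i ≤ s j)
    → (∀ (i : Fin n) → 1 ≤ r i)
    → (∀ (i : Fin n) → 1 ≤ s i)
    → ∃ (λ (k : Fin n) → s k < r k × mu k < la k)
    → (Grow n la mu r s ≈ Gtilde n la mu r s) × (Gtilde n la mu r s ≈ 0s)
lemma3p14 n la mu r s la↓ mu↓ _ r↑ s↑ _ _ (k , sk<rk , muk<lak) =
  (λ e → trans (Grow≈0 e) (sym (Gtilde≈0 e))) , Gtilde≈0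
  where
  Grow≈0 : Grow n la mu r s ≈ 0s
  Grow≈0 = Grow≈0s n la mu r s k sk<rk muk<lak
  Gtilde≈0 : Gtilde n la mu r s ≈ 0s
  Gtilde≈0 = Gtilde≈0s n la mu r s la↓ mu↓ r↑ s↑ k sk<rk muk<lak
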